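{- Let $s\ge1$, $t\ge 2$, $G\in\mathcal{G}_{s,t}$ with root $r$, and let $C$ be a non-trivial configuration with $k$ pebble-free vertices in $S$. If $k$ is even, $C_T=k+2$, and $C(v)$ is odd for every $v\in T$, then Mover has a winning strategy.
   Context: A configuration $C$ on a graph $G$ is a function $C:V(G)\to\mathbb{Z}_{\ge 0}$. A pebbling move removes two pebbles from a vertex and places one pebble on an adjacent vertex. The Two-Player Pebbling Game on $G$ with root $r$ and starting configuration $C$ is played by Mover and Defender in rounds: in each round Mover makes a pebbling move and then Defender makes a pebbling move; each player must take their turn. If Mover pebbles from $u$ to $v$, Defender may not pebble from $v$ to $u$ in the same round. Mover wins if at any time the root has at least one pebble; Defender wins if the root has no pebble and there are no more pebbling moves. A winning strategy is a rule choosing a player's moves as a function of the current position which guarantees that player wins. For integers $s,t\ge1$, $\mathcal{G}_{s,t}$ is the class of all graphs $(K_1\cup \overline{K_t})\vee H$, where $H$ is any graph on $s$ vertices, $\overline{K_t}$ is the edgeless graph on $t$ vertices, $\cup$ is disjoint union and $\vee$ is the join. The root $r$ is the vertex of $K_1$; $S=V(H)$, $T=V(\overline{K_t})$. A configuration is non-trivial if each vertex of $S$ has 0 or 1 pebbles and the root has no pebbles. A vertex is pebble-free if it has no pebbles. $k$ is the number of pebble-free vertices of $S$, and $C_T=\sum_{v\in T}\lfloor C(v)/2\rfloor$. -}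

module Defs where

open import Data.Nat using (ℕ; zero; suc; _+_; _∸_; _≤_; _/_; _%_)
open import Data.Fin using (Fin)
import Data.Fin as F
open import Data.Product using (_×_; ∃-syntax; Σ-syntax)
open import Data.Empty using (⊥)
open import Data.Unit using (⊤)
open import Relation.Nullary using (¬_; Dec; yes; no)
open import Relation.Binary.PropositionalEquality using (_≡_; refl; cong)

record Graph (s : ℕ) : Set₁ where
  field
    Adj    : Fin s → Fin s → Set
    sym    : ∀ {i j} → Adj i j → Adj j i
    irrefl : ∀ {i} → ¬ Adj i i

-- Vertices of (K₁ ∪ K̄_t) ∨ H : the root, the s vertices of S = V(H),
-- and the t vertices of T = V(K̄_t).
data V (s t : ℕ) : Set where
  root : V s t
  sv   : Fin s → V s t
  tv   : Fin t → V s t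

_≟V_ : ∀ {s t} → (x y : V s t) → Dec (x ≡ y)
root ≟V root = yes refl
root ≟V sv _ = no λ ()
root ≟V tv _ = no λ ()
sv _ ≟V root = no λ ()
sv i ≟V sv j with i F.≟ j
... | yes refl = yes refl
... | no ne = no λ { refl → ne refl }
sv _ ≟V tv _ = no λ ()
tv _ ≟V root = no λ ()
tv _ ≟V sv _ = no λ ()
tv i ≟V tv j with i F.≟ j
... | yes refl = yes refl
... | no ne = no λ { refl → ne refl }

Adj : ∀ {s t} → Graph s → V s t → V s t → Set
Adj H root   root   = ⊥
Adj H root   (sv _) = ⊤
Adj H root   (tv _) = ⊥
Adj H (sv _) root   = ⊤
Adj H (sv i) (sv j) = Graph.Adj H i j
Adj H (sv _) (tv _) = ⊤
Adj H (tv _) root   = ⊥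
Adj H (tv _) (sv _) = ⊤
Adj H (tv _) (tv _) = ⊥

Config : ℕ → ℕ → Set
Config s t = V s t → ℕ

Move : ∀ {s t} → Graph s → Config s t → V s t → V s t → Set
Move H C u v = Adj H u v × 2 ≤ C u

apply : ∀ {s t} → Config s t → V s t → V s t → Config s t
apply C u v w with w ≟V u
... | yes _ = C u ∸ 2
... | no _ with w ≟V v
...   | yes _ = suc (C v)
...   | no _  = C w

-- Mover has a winning strategy (game tree is finite: every move
-- decreases the total number of pebbles).
-- MoverWinsD H C u v  : position C, Defender to move, after Mover pebbled
--                       from u to v (so Defender may not pebble from v to u).
mutual
  data MoverWins {s t} (H : Graph s) (C : Config s t) : Set where
    rootM : 1 ≤ C root → MoverWins H C
    moveM : (u v : V s t) → Move H C u v →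
            MoverWinsD H (apply C u v) u v → MoverWins H C

  data MoverWinsD {s t} (H : Graph s) (C : Config s t) (u v : V s t) : Set where
    rootD : 1 ≤ C root → MoverWinsD H C u v
    allD  : (Σ[ x ∈ V s t ] Σ[ y ∈ V s t ] (Move H C x y × ¬ (x ≡ v × y ≡ u))) →
            ((x y : V s t) → Move H C x y → ¬ (x ≡ v × y ≡ u) →
               MoverWins H (apply C x y)) →
            MoverWinsD H C u v

sumFin : (n : ℕ) → (Fin n → ℕ) → ℕ
sumFin zero    f = 0
sumFin (suc n) f = f F.zero + sumFin n (λ i → f (F.suc i))

isZero : ℕ → ℕ
isZero zero    = 1
isZero (suc _) = 0

NonTrivial : ∀ {s t} → Config s t → Set
NonTrivial {s} C = C root ≡ 0 × ((i : Fin s) → C (sv i) ≤ 1)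

kFree : ∀ {s t} → Config s t → ℕ
kFree {s} C = sumFin s (λ i → isZero (C (sv i)))

CT : ∀ {s t} → Config s t → ℕ
CT {t = t} C = sumFin t (λ j → C (tv j) / 2)

module Submission where

-- Call a configuration quiet if the root is empty, every
-- S-vertex holds at most one pebble and every T-vertex an odd number, and
-- balanced if C_T = k + 2.  In a quiet configuration the only legal moves go
-- from T into S, and a Defender move onto an occupied S-vertex doubles it,
-- after which Mover pebbles that vertex to the root.
--
--  * k = 2(m+1): Mover fills an empty S-vertex from T.  Defender must answer
--    T → S; onto an occupied vertex he loses, onto an empty one the position
--    is again quiet and balanced with k = 2m  (moverWins-even, by induction).
--  * k = 0: all of S is occupied and C_T = 2.  Mover doubles an S-vertex x.
--    Defender's only defence is to send x's pebbles into a T-vertex w other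
--    than Mover's source; w had an odd count, so it now holds two pebbles and
--    Mover sends one back to x.  Now S is full again, C_T = 1, and every
--    Defender move doubles an S-vertex  (allOccupiedWins).

open import Defs
open import Data.Nat using (ℕ; zero; suc; _≤_; _*_; _+_; _%_; _∸_; _/_; z≤n; s≤s)
open import Data.Nat.Properties
  using (≤-refl; ≤-reflexive; ≤-trans; ≤-antisym; n≤1+n; m≤n+m; suc-injective; +-comm;
         m+n≡0⇒m≡0; m+n≡0⇒n≡0; +-0-commutativeMonoid)
open import Data.Nat.DivMod using (m≡m%n+[m/n]*n; m*n/n≡m; m/n≡1+[m∸n]/n; [m+n]%n≡m%n)
open import Data.Nat.Divisibility using (m%n≡0⇒n∣m; divides)
open import Algebra.Properties.CommutativeMonoid.Sum +-0-commutativeMonoid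
  using (sum; sum-remove; sum-cong-≗)
open import Data.Fin using (Fin)
import Data.Fin as F
import Data.Fin.Properties as FP
open import Data.Vec.Functional using (removeAt)
open import Data.Product using (_×_; _,_; Σ-syntax)
open import Data.Unit using (tt)
open import Function using (_∘_)
open import Relation.Nullary using (¬_; Dec; yes; no; contradiction)
open import Relation.Binary.PropositionalEquality

private variable
  s t : ℕ

half-pos⇒two : ∀ c → 1 ≤ c / 2 → 2 ≤ c
half-pos⇒two (suc (suc c)) _ = s≤s (s≤s z≤n)

odd⇒pos : ∀ c → c % 2 ≡ 1 → 1 ≤ c
odd⇒pos (suc c) _ = s≤s z≤n

isZero-pos⇒empty : ∀ c → 1 ≤ isZero c → c ≡ 0
isZero-pos⇒empty zero _ = refl

isZero-zero⇒occupied : ∀ c → isZero c ≡ 0 → 1 ≤ c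
isZero-zero⇒occupied (suc c) _ = s≤s z≤n

odd-half-suc : ∀ c → c % 2 ≡ 1 → suc c / 2 ≡ suc (c / 2)
odd-half-suc c odd = begin
  suc c / 2                     ≡⟨ cong (λ z → suc z / 2) (m≡m%n+[m/n]*n c 2) ⟩
  suc (c % 2 + c / 2 * 2) / 2   ≡⟨ cong (λ r → suc (r + c / 2 * 2) / 2) odd ⟩
  suc (c / 2) * 2 / 2           ≡⟨ m*n/n≡m (suc (c / 2)) 2 ⟩
  suc (c / 2)                   ∎
  where open ≡-Reasoning

minus-two-parity : ∀ c → 2 ≤ c → (c ∸ 2) % 2 ≡ c % 2
minus-two-parity (suc zero)    (s≤s ())
minus-two-parity (suc (suc c)) _ =
  sym (trans (cong (_% 2) (+-comm 2 c)) ([m+n]%n≡m%n c 2))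

sumFin≡sum : ∀ n (f : Fin n → ℕ) → sumFin n f ≡ sum f
sumFin≡sum zero    f = refl
sumFin≡sum (suc n) f = cong (f F.zero +_) (sumFin≡sum n (f ∘ F.suc))

sumFin-bump : ∀ {n} (f g : Fin n → ℕ) (j : Fin n) →
  (∀ i → i ≢ j → f i ≡ g i) → f j ≡ suc (g j) → sumFin n f ≡ suc (sumFin n g)
sumFin-bump {suc n} f g j agree bump = begin
  sumFin (suc n) f                 ≡⟨ split f ⟩
  f j + sum (removeAt f j)         ≡⟨ cong₂ _+_ bump rest ⟩
  suc (g j + sum (removeAt g j))   ≡⟨ cong suc (split g) ⟨
  suc (sumFin (suc n) g)           ∎
  where
  open ≡-Reasoning
  split : ∀ h → sumFin (suc n) h ≡ h j + sum (removeAt h j)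
  split h = trans (sumFin≡sum (suc n) h) (sum-remove h)
  rest : sum (removeAt f j) ≡ sum (removeAt g j)
  rest = sum-cong-≗ (λ i → agree (F.punchIn j i) (FP.punchInᵢ≢i j i))

sumFin-pos : ∀ n (f : Fin n → ℕ) → 1 ≤ sumFin n f → Σ[ i ∈ Fin n ] 1 ≤ f i
sumFin-pos (suc n) f pos with f F.zero in eq
... | suc _ = F.zero , subst (1 ≤_) (sym eq) (s≤s z≤n)
... | zero with sumFin-pos n (f ∘ F.suc) pos
...   | i , p = F.suc i , p

sumFin-zero : ∀ n (f : Fin n → ℕ) → sumFin n f ≡ 0 → ∀ i → f i ≡ 0
sumFin-zero (suc n) f z F.zero    = m+n≡0⇒m≡0 (f F.zero) z
sumFin-zero (suc n) f z (F.suc i) = sumFin-zero n (f ∘ F.suc) (m+n≡0⇒n≡0 (f F.zero) z) i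

apply-source : (C : Config s t) (u v : V s t) → apply C u v u ≡ C u ∸ 2
apply-source C u v with u ≟V u
... | yes _ = refl
... | no u≢u = contradiction refl u≢u

apply-target : (C : Config s t) (u v : V s t) → u ≢ v → apply C u v v ≡ suc (C v)
apply-target C u v u≢v with v ≟V u
... | yes v≡u = contradiction (sym v≡u) u≢v
... | no _ with v ≟V v
...   | yes _ = refl
...   | no v≢v = contradiction refl v≢v

apply-other : (C : Config s t) (u v w : V s t) → w ≢ u → w ≢ v → apply C u v w ≡ C w
apply-other C u v w w≢u w≢v with w ≟V u
... | yes w≡u = contradiction w≡u w≢u
... | no _ with w ≟V v
...   | yes w≡v = contradiction w≡v w≢v
...   | no _ = refl

apply-mono : (C : Config s t) (u v w : V s t) → w ≢ u → C w ≤ apply C u v w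
apply-mono C u v w w≢u with w ≟V v
... | yes refl = subst (C v ≤_) (sym (apply-target C u v (w≢u ∘ sym))) (n≤1+n (C v))
... | no w≢v   = subst (C w ≤_) (sym (apply-other C u v w w≢u w≢v)) ≤-refl

apply-doubles : (C : Config s t) (u v : V s t) → u ≢ v → 1 ≤ C v → 2 ≤ apply C u v v
apply-doubles C u v u≢v occ = subst (2 ≤_) (sym (apply-target C u v u≢v)) (s≤s occ)

sv-injective : {i j : Fin s} → sv {s} {t} i ≡ sv j → i ≡ j
sv-injective refl = refl

tv-injective : {i j : Fin t} → tv {s} {t} i ≡ tv j → i ≡ j
tv-injective refl = refl

CT-fromT : (C : Config s t) (u : Fin t) (x : Fin s) → 2 ≤ C (tv u) →
  CT C ≡ suc (CT (apply C (tv u) (sv x)))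
CT-fromT C u x two = sumFin-bump _ _ u
  (λ j j≢u → cong (_/ 2) (sym (apply-other C (tv u) (sv x) (tv j) (j≢u ∘ tv-injective) λ ())))
  (trans (m/n≡1+[m∸n]/n two) (cong (λ c → suc (c / 2)) (sym (apply-source C (tv u) (sv x)))))

CT-intoOddT : (C : Config s t) (x : Fin s) (w : Fin t) → C (tv w) % 2 ≡ 1 →
  CT (apply C (sv x) (tv w)) ≡ suc (CT C)
CT-intoOddT C x w odd = sumFin-bump _ _ w
  (λ j j≢w → cong (_/ 2) (apply-other C (sv x) (tv w) (tv j) (λ ()) (j≢w ∘ tv-injective)))
  (trans (cong (_/ 2) (apply-target C (sv x) (tv w) λ ())) (odd-half-suc (C (tv w)) odd))

kFree-fill : (C : Config s t) (j : Fin t) (y : Fin s) → C (sv y) ≡ 0 →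
  kFree C ≡ suc (kFree (apply C (tv j) (sv y)))
kFree-fill C j y empty = sumFin-bump _ _ y
  (λ i i≢y → cong isZero (sym (apply-other C (tv j) (sv y) (sv i) (λ ()) (i≢y ∘ sv-injective))))
  (trans (cong isZero empty) (sym (cong (suc ∘ isZero) (apply-target C (tv j) (sv y) λ ()))))

record Quiet (C : Config s t) : Set where
  field
    rootEmpty  : C root ≡ 0
    sAtMostOne : ∀ i → C (sv i) ≤ 1
    tOdd       : ∀ j → C (tv j) % 2 ≡ 1
open Quiet

Balanced : Config s t → Set
Balanced C = CT C ≡ kFree C + 2

firingT : (C : Config s t) → 1 ≤ CT C → Σ[ j ∈ Fin t ] 2 ≤ C (tv j)
firingT {t = t} C pos with sumFin-pos t _ pos
... | j , half = j , half-pos⇒two (C (tv j)) half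

balanced-firingT : (C : Config s t) → Balanced C → Σ[ j ∈ Fin t ] 2 ≤ C (tv j)
balanced-firingT C bal =
  firingT C (subst (1 ≤_) (sym bal) (≤-trans (s≤s z≤n) (m≤n+m 2 (kFree C))))

emptyS : (C : Config s t) → 1 ≤ kFree C → Σ[ i ∈ Fin s ] C (sv i) ≡ 0
emptyS {s = s} C pos with sumFin-pos s _ pos
... | i , one = i , isZero-pos⇒empty (C (sv i)) one

allOccupied : (C : Config s t) → Quiet C → kFree C ≡ 0 → ∀ i → C (sv i) ≡ 1
allOccupied {s = s} C q k≡0 i = ≤-antisym (sAtMostOne q i)
  (isZero-zero⇒occupied (C (sv i)) (sumFin-zero s _ k≡0 i))

-- Filling an empty S-vertex y from a firing T-vertex j keeps the configuration
-- quiet and balanced (both C_T and k drop by one).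
fill-quiet : (C : Config s t) (j : Fin t) (y : Fin s) → Quiet C →
  2 ≤ C (tv j) → C (sv y) ≡ 0 → Quiet (apply C (tv j) (sv y))
fill-quiet C j y q two empty = record
  { rootEmpty  = trans (apply-other C (tv j) (sv y) root (λ ()) (λ ())) (rootEmpty q)
  ; sAtMostOne = atMostOne
  ; tOdd       = odd
  }
  where
  atMostOne : ∀ i → apply C (tv j) (sv y) (sv i) ≤ 1
  atMostOne i = cases (i F.≟ y)
    where
    cases : Dec (i ≡ y) → apply C (tv j) (sv y) (sv i) ≤ 1
    cases (yes refl) = subst (_≤ 1) (sym (trans (apply-target C (tv j) (sv i) λ ()) (cong suc empty))) ≤-refl
    cases (no i≢y) = subst (_≤ 1) (sym (apply-other C (tv j) (sv y) (sv i) (λ ()) (i≢y ∘ sv-injective)))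
                           (sAtMostOne q i)
  odd : ∀ i → apply C (tv j) (sv y) (tv i) % 2 ≡ 1
  odd i = cases (i F.≟ j)
    where
    cases : Dec (i ≡ j) → apply C (tv j) (sv y) (tv i) % 2 ≡ 1
    cases (yes refl) = trans (cong (_% 2) (apply-source C (tv i) (sv y)))
                             (trans (minus-two-parity _ two) (tOdd q i))
    cases (no i≢j)   = trans (cong (_% 2) (apply-other C (tv j) (sv y) (tv i) (i≢j ∘ tv-injective) (λ ())))
                             (tOdd q i)

fill-balanced : (C : Config s t) (j : Fin t) (y : Fin s) →
  2 ≤ C (tv j) → C (sv y) ≡ 0 → Balanced C → Balanced (apply C (tv j) (sv y))
fill-balanced C j y two empty bal = suc-injective (begin
  suc (CT (apply C (tv j) (sv y)))      ≡⟨ CT-fromT C j y two ⟨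
  CT C                                  ≡⟨ bal ⟩
  kFree C + 2                           ≡⟨ cong (_+ 2) (kFree-fill C j y empty) ⟩
  suc (kFree (apply C (tv j) (sv y)) + 2) ∎)
  where open ≡-Reasoning

win-doubledS : (H : Graph s) (C : Config s t) (i : Fin s) → 2 ≤ C (sv i) → MoverWins H C
win-doubledS H C i two = moveM (sv i) root (tt , two) (rootD (s≤s z≤n))

-- With the root empty and at most one pebble on each S-vertex, Defender can
-- only pebble from T into S, and does have such a move when some T-vertex
-- fires.  Replies onto occupied S-vertices double them, so Mover wins as soon
-- as he wins after every reply onto an empty S-vertex.
defender-forced : (H : Graph s) (C : Config s t) {u : V s t} {x : Fin s} →
  C root ≡ 0 → (∀ i → C (sv i) ≤ 1) → Σ[ j ∈ Fin t ] 2 ≤ C (tv j) →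
  (∀ j y → 2 ≤ C (tv j) → C (sv y) ≡ 0 → MoverWins H (apply C (tv j) (sv y))) →
  MoverWinsD H C u (sv x)
defender-forced {s} {t} H C {u} {x} root0 atMostOne (j₀ , j₀-fires) onEmpty =
  allD (tv j₀ , sv x , (tt , j₀-fires) , λ { (() , _) }) reply
  where
  reply : (a b : V s t) → Move H C a b → ¬ (a ≡ sv x × b ≡ u) → MoverWins H (apply C a b)
  reply root   _      (_ , two) _ = contradiction (subst (2 ≤_) root0 two) λ ()
  reply (sv i) _      (_ , two) _ = contradiction (≤-trans two (atMostOne i)) λ { (s≤s ()) }
  reply (tv j) root   (() , _)  _
  reply (tv j) (tv _) (() , _)  _
  reply (tv j) (sv y) (_ , two) _ with C (sv y) in occupancy
  ... | zero  = onEmpty j y two occupancy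
  ... | suc _ = win-doubledS H _ y
                  (apply-doubles C (tv j) (sv y) (λ ()) (subst (1 ≤_) (sym occupancy) (s≤s z≤n)))

-- Defender has just pebbled the doubled S-vertex x into a T-vertex w with an
-- odd pile.  Mover sends a pebble from w back to x; then every S-vertex holds
-- exactly one pebble and C_T = 1, so Defender must double an S-vertex.
bounce-back : (H : Graph s) (D : Config s t) (x : Fin s) (w : Fin t) →
  D root ≡ 0 → D (sv x) ≡ 2 → (∀ i → i ≢ x → D (sv i) ≡ 1) →
  D (tv w) % 2 ≡ 1 → CT D ≡ 1 → MoverWins H (apply D (sv x) (tv w))
bounce-back {s} {t} H D x w root0 atX elsewhere odd ct = moveM (tv w) (sv x) (tt , w-fires)
  (defender-forced H E root-E (≤-reflexive ∘ full-E) (firingT E (≤-reflexive (sym CT-E)))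
    λ _ y _ empty → contradiction (trans (sym (full-E y)) empty) λ ())
  where
  D₁ E : Config s t
  D₁ = apply D (sv x) (tv w)
  E  = apply D₁ (tv w) (sv x)
  w-fires : 2 ≤ D₁ (tv w)
  w-fires = subst (2 ≤_) (sym (apply-target D (sv x) (tv w) λ ())) (s≤s (odd⇒pos _ odd))
  CT-E : CT E ≡ 1
  CT-E = suc-injective (trans (sym (CT-fromT D₁ w x w-fires))
                              (trans (CT-intoOddT D x w odd) (cong suc ct)))
  full-E : ∀ y → E (sv y) ≡ 1
  full-E y = cases (y F.≟ x)
    where
    cases : Dec (y ≡ x) → E (sv y) ≡ 1
    cases (yes refl) = trans (apply-target D₁ (tv w) (sv y) λ ())
                             (cong suc (trans (apply-source D (sv y) (tv w)) (cong (_∸ 2) atX)))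
    cases (no y≢x)   = trans (apply-other D₁ (tv w) (sv x) (sv y) (λ ()) (y≢x ∘ sv-injective))
                             (trans (apply-other D (sv x) (tv w) (sv y) (y≢x ∘ sv-injective) (λ ())) (elsewhere y y≢x))
  root-E : E root ≡ 0
  root-E = trans (apply-other D₁ (tv w) (sv x) root (λ ()) (λ ()))
                 (trans (apply-other D (sv x) (tv w) root (λ ()) (λ ())) root0)

-- k = 0: every S-vertex is occupied and C_T = 2.  Mover doubles x from a
-- firing T-vertex u.  Defender cannot touch the other S-vertices; any reply
-- except pebbling x into a T-vertex w ≠ u leaves or creates a doubled
-- S-vertex or reaches the root, and that one reply is met by bounce-back.
allOccupiedWins : (H : Graph s) (x : Fin s) (C : Config s t) → Quiet C →
  (∀ i → C (sv i) ≡ 1) → CT C ≡ 2 → MoverWins H C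
allOccupiedWins {s} {t} H x C q full ct with firingT C (subst (1 ≤_) (sym ct) (s≤s z≤n))
... | u , u-fires =
  moveM (tv u) (sv x) (tt , u-fires) (allD (sv x , root , (tt , x-doubled) , λ { (_ , ()) }) reply)
  where
  D : Config s t
  D = apply C (tv u) (sv x)
  D-at-x : D (sv x) ≡ 2
  D-at-x = trans (apply-target C (tv u) (sv x) λ ()) (cong suc (full x))
  x-doubled : 2 ≤ D (sv x)
  x-doubled = ≤-reflexive (sym D-at-x)
  elsewhere : ∀ i → i ≢ x → D (sv i) ≡ 1
  elsewhere i i≢x = trans (apply-other C (tv u) (sv x) (sv i) (λ ()) (i≢x ∘ sv-injective)) (full i)
  root-D : D root ≡ 0
  root-D = trans (apply-other C (tv u) (sv x) root (λ ()) (λ ())) (rootEmpty q)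
  CT-D : CT D ≡ 1
  CT-D = suc-injective (trans (sym (CT-fromT C u x u-fires)) ct)
  fromX : (b : V s t) → Adj H (sv x) b → b ≢ tv u → MoverWins H (apply D (sv x) b)
  fromX root   _   _   = rootM (s≤s z≤n)
  fromX (sv y) adj _   = win-doubledS H _ y (apply-doubles D (sv x) (sv y) x≢y
                           (≤-reflexive (sym (elsewhere y (x≢y ∘ cong sv ∘ sym)))))
    where
    x≢y : sv x ≢ sv y
    x≢y x≡y = Graph.irrefl H (subst (Graph.Adj H x) (sym (sv-injective x≡y)) adj)
  fromX (tv w) _   w≢u = bounce-back H D x w root-D D-at-x elsewhere
    (trans (cong (_% 2) (apply-other C (tv u) (sv x) (tv w) w≢u λ ())) (tOdd q w)) CT-D
  reply : (a b : V s t) → Move H D a b → ¬ (a ≡ sv x × b ≡ tv u) → MoverWins H (apply D a b)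
  reply root   _      (_ , two) _ = contradiction (subst (2 ≤_) root-D two) λ ()
  reply (tv j) root   (() , _)  _
  reply (tv j) (tv _) (() , _)  _
  reply (tv j) (sv y) _         _ =
    win-doubledS H _ x (≤-trans x-doubled (apply-mono D (tv j) (sv y) (sv x) λ ()))
  reply (sv i) b (adj , two) notBack = cases (i F.≟ x)
    where
    cases : Dec (i ≡ x) → MoverWins H (apply D (sv i) b)
    cases (yes refl) = fromX b adj (λ b≡tu → notBack (refl , b≡tu))
    cases (no i≢x)   = contradiction (subst (2 ≤_) (elsewhere i i≢x) two) λ { (s≤s ()) }

-- k = 2m: while empty S-vertices remain Mover fills one; by defender-forced
-- Defender must fill another, which returns to a quiet balanced position with
-- k = 2(m - 1).
moverWins-even : (H : Graph s) → Fin s → (m : ℕ) (C : Config s t) →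
  Quiet C → Balanced C → kFree C ≡ m * 2 → MoverWins H C
moverWins-even H x₀ zero C q bal k≡0 =
  allOccupiedWins H x₀ C q (allOccupied C q k≡0) (trans bal (cong (_+ 2) k≡0))
moverWins-even {s} {t} H x₀ (suc m) C q bal k≡
  with emptyS C (subst (1 ≤_) (sym k≡) (s≤s z≤n)) | balanced-firingT C bal
... | x , x-empty | u , u-fires = moveM (tv u) (sv x) (tt , u-fires)
  (defender-forced H D (rootEmpty q-D) (sAtMostOne q-D) (balanced-firingT D bal-D) continue)
  where
  D : Config s t
  D = apply C (tv u) (sv x)
  q-D : Quiet D
  q-D = fill-quiet C u x q u-fires x-empty
  bal-D : Balanced D
  bal-D = fill-balanced C u x u-fires x-empty bal
  k-D : kFree D ≡ suc (m * 2)
  k-D = suc-injective (trans (sym (kFree-fill C u x x-empty)) k≡)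
  continue : ∀ j y → 2 ≤ D (tv j) → D (sv y) ≡ 0 → MoverWins H (apply D (tv j) (sv y))
  continue j y j-fires y-empty = moverWins-even H x₀ m (apply D (tv j) (sv y))
    (fill-quiet D j y q-D j-fires y-empty) (fill-balanced D j y j-fires y-empty bal-D)
    (suc-injective (trans (sym (kFree-fill D j y y-empty)) k-D))

-- A non-trivial configuration with odd T-piles is quiet; k even means k = 2m.
lemma3p8 : (s t : ℕ) → 1 ≤ s → 2 ≤ t → (H : Graph s) → (C : Config s t) →
    NonTrivial C → kFree C % 2 ≡ 0 → CT C ≡ kFree C + 2 →
    ((j : Fin t) → C (tv j) % 2 ≡ 1) →
    MoverWins H C
lemma3p8 (suc s) t _ _ H C (root0 , atMostOne) even balanced odd
  with m%n≡0⇒n∣m (kFree C) 2 even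
... | divides m k≡m*2 = moverWins-even H F.zero m C quiet balanced k≡m*2
  where
  quiet : Quiet C
  quiet = record { rootEmpty = root0 ; sAtMostOne = atMostOne ; tOdd = odd }
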